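{- If $G$ is a positive simple graph and $H$ is any looped-simple graph, then the categorical product $G\times H$ is positive.
   Context: A looped-simple graph is a graph without multiple edges in which loops are allowed. The categorical product $G\times H$ has vertex set $V(G)\times V(H)$, and $(i_1,i_2)$ is adjacent to $(j_1,j_2)$ iff $i_1j_1\in E(G)$ and $i_2j_2\in E(H)$ (a loop at $i_2$ counts as $i_2i_2\in E(H)$); since $G$ has no loops, $G\times H$ is simple. An edge-weighted graph on $[m]$ is a symmetric real matrix $(\beta_{ij})$ (weights may be negative); for a simple graph $G$, $\hom(G,H)=\sum_{\varphi:V(G)\to[m]}\prod_{uv\in E(G)}\beta_{\varphi(u)\varphi(v)}$. A simple graph $G$ is positive if $\hom(G,H)\ge0$ for every edge-weighted graph $H$ (equivalently $t(G,W)=\int_{[0,1]^{V(G)}}\prod_{uv\in E(G)}W(x_u,x_v)\,dx\ge0$ for every bounded symmetric measurable $W:[0,1]^2\to\mathbb R$).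
   Formalization: The edge weights of the edge-weighted graphs in the definition of positivity are rational instead of real. -}

module Defs where

open import Data.Nat using (ℕ; zero; suc; _*_; _<ᵇ_)
open import Data.Fin using (Fin; zero; suc; toℕ; quotient; remainder)
open import Data.Bool using (Bool; true; false; _∧_; if_then_else_)
open import Data.Rational using (ℚ; 0ℚ; 1ℚ; _+_; _≤_) renaming (_*_ to _*ℚ_)
open import Data.Vec.Functional using (_∷_)
open import Relation.Binary.PropositionalEquality using (_≡_; refl; cong₂; trans)

record SimpleGraph : Set where
  field
    n     : ℕ
    adj   : Fin n → Fin n → Bool
    sym   : ∀ i j → adj i j ≡ adj j i
    noLoop : ∀ i → adj i i ≡ false

record LoopedSimpleGraph : Set where
  field
    n   : ℕ
    adj : Fin n → Fin n → Bool
    sym : ∀ i j → adj i j ≡ adj j i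

_×ᵍ_ : SimpleGraph → LoopedSimpleGraph → SimpleGraph
G ×ᵍ H = record
  { n = nG * nH
  ; adj = λ x y → G.adj (quotient nH x) (quotient nH y) ∧ H.adj (remainder {nG} nH x) (remainder {nG} nH y)
  ; sym = λ x y → cong₂ _∧_ (G.sym (quotient nH x) (quotient nH y)) (H.sym (remainder {nG} nH x) (remainder {nG} nH y))
  ; noLoop = λ x → trans (cong₂ _∧_ (G.noLoop (quotient nH x)) refl) refl
  }
  where
  module G = SimpleGraph G
  module H = LoopedSimpleGraph H
  nG = G.n
  nH = H.n

sumFin : (m : ℕ) → (Fin m → ℚ) → ℚ
sumFin zero    f = 0ℚ
sumFin (suc m) f = f zero + sumFin m (λ i → f (suc i))

prodFin : (m : ℕ) → (Fin m → ℚ) → ℚ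
prodFin zero    f = 1ℚ
prodFin (suc m) f = f zero *ℚ prodFin m (λ i → f (suc i))

sumMaps : (n m : ℕ) → ((Fin n → Fin m) → ℚ) → ℚ
sumMaps zero    m F = F (λ ())
sumMaps (suc n) m F = sumFin m (λ i → sumMaps n m (λ φ → F (i ∷ φ)))

record WeightedGraph : Set where
  field
    m    : ℕ
    β    : Fin m → Fin m → ℚ
    symβ : ∀ i j → β i j ≡ β j i

hom : SimpleGraph → WeightedGraph → ℚ
hom G W = sumMaps n m (λ φ →
            prodFin n (λ u → prodFin n (λ v →
              if (toℕ u <ᵇ toℕ v) ∧ adj u v then β (φ u) (φ v) else 1ℚ)))
  where
  open SimpleGraph G
  open WeightedGraph W

Positive : SimpleGraph → Set
Positive G = ∀ (W : WeightedGraph) → 0ℚ ≤ hom G W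

-- A map V(G) × V(H) → [m] is the same as a map ψ : V(G) → [m]^V(H), via
-- φ(u, i) = ψ(u)(i).  Grouping the edges (u, i)(v, j) of G × H by the edge uv
-- of G, the weight of φ becomes the product over the edges uv of G of
-- ∏ β(ψ(u)(i), ψ(v)(j)), taken over the ordered pairs (i, j) with ij ∈ E(H).
-- This is a symmetric weight on [m]^V(H), so hom(G × H, W) = hom(G, W^H) for
-- an edge-weighted graph W^H, and positivity of G applied to W^H gives the claim.
module Submission where

open import Algebra.Bundles using (Monoid)
import Algebra.Properties.CommutativeMonoid.Sum as CommutativeMonoidSum
import Algebra.Properties.Monoid.Sum as MonoidSum
open import Data.Bool using (Bool; true; false; _∧_; if_then_else_)
open import Data.Bool.Properties using (∧-zeroʳ; ∧-identityʳ; if-∧; if-cong; if-cong-then)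
open import Data.Empty using (⊥-elim)
open import Data.Fin using (Fin; _<_; zero; suc; toℕ; quotient; remainder; combine; splitAt; finToFun; _↑ˡ_; _↑ʳ_)
open import Data.Fin.Properties using (remQuot-combine; combine-monoˡ-<; <-cmp; <-asym)
open import Data.Nat using (zero; suc; _+_; _*_; _^_; _<ᵇ_)
open import Data.Nat.Properties using (<ᵇ⇒<; <⇒<ᵇ; <ᵇ-reflects-<)
open import Data.Product using (proj₁; proj₂; uncurry)
open import Data.Rational using (ℚ; 0ℚ; 1ℚ; _≤_)
import Data.Rational as ℚ
import Data.Rational.Properties as ℚ
open import Data.Sum using (inj₁; inj₂)
open import Data.Vec.Functional using (Vector; _∷_; _++_; head; tail; concat)
open import Data.Vec.Functional.Properties using (∷-cong; ++-cong)
open import Function using (_∘_)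
open import Relation.Binary using (tri<; tri≈; tri>; _Preserves_⟶_)
open import Relation.Binary.PropositionalEquality
  using (_≡_; _≢_; _≗_; refl; sym; trans; cong; cong₂; subst; module ≡-Reasoning)
open import Relation.Nullary.Reflects using (det; fromEquivalence)

open import Defs

open MonoidSum ℚ.+-0-monoid using () renaming (sum to ∑; sum-cong-≗ to ∑-cong)
open CommutativeMonoidSum ℚ.*-1-commutativeMonoid using ()
  renaming (sum to ∏; sum-cong-≗ to ∏-cong; ∑-comm to ∏-comm; sum-replicate-zero to ∏-replicate-one)

module _ {c ℓ} (M : Monoid c ℓ) where
  open Monoid M using (Carrier; _≈_; _∙_; identityˡ; assoc; ∙-congˡ; setoid)
  open MonoidSum M using (sum; sum-syntax)
  open import Relation.Binary.Reasoning.Setoid setoid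

  sum-↑ : ∀ a b (f : Vector Carrier (a + b)) →
          sum f ≈ sum (f ∘ (_↑ˡ b)) ∙ sum (f ∘ (a ↑ʳ_))
  sum-↑ zero    b f = Monoid.sym M (identityˡ (sum f))
  sum-↑ (suc a) b f = begin
    f zero ∙ sum (f ∘ suc)                                            ≈⟨ ∙-congˡ (sum-↑ a b (f ∘ suc)) ⟩
    f zero ∙ (sum (f ∘ suc ∘ (_↑ˡ b)) ∙ sum (f ∘ suc ∘ (a ↑ʳ_)))      ≈⟨ assoc _ _ _ ⟨
    sum (f ∘ (_↑ˡ b)) ∙ sum (f ∘ (suc a ↑ʳ_))                         ∎

  sum-combine : ∀ a b (f : Vector Carrier (a * b)) →
                sum f ≈ ∑[ i < a ] ∑[ j < b ] f (combine i j)
  sum-combine zero    b f = Monoid.refl M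
  sum-combine (suc a) b f = begin
    sum f                                          ≈⟨ sum-↑ b (a * b) f ⟩
    sum (f ∘ (_↑ˡ (a * b))) ∙ sum (f ∘ (b ↑ʳ_))    ≈⟨ ∙-congˡ (sum-combine a b (f ∘ (b ↑ʳ_))) ⟩
    ∑[ i < suc a ] ∑[ j < b ] f (combine i j)      ∎

sumFin≡∑ : ∀ m (f : Fin m → ℚ) → sumFin m f ≡ ∑ f
sumFin≡∑ zero    f = refl
sumFin≡∑ (suc m) f = cong (f zero ℚ.+_) (sumFin≡∑ m (f ∘ suc))

prodFin≡∏ : ∀ m (f : Fin m → ℚ) → prodFin m f ≡ ∏ f
prodFin≡∏ zero    f = refl
prodFin≡∏ (suc m) f = cong (f zero ℚ.*_) (prodFin≡∏ m (f ∘ suc))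

sumFin-cong : ∀ m {f g : Fin m → ℚ} → f ≗ g → sumFin m f ≡ sumFin m g
sumFin-cong zero    f≗g = refl
sumFin-cong (suc m) f≗g = cong₂ ℚ._+_ (f≗g zero) (sumFin-cong m (f≗g ∘ suc))

prodFin-cong : ∀ m {f g : Fin m → ℚ} → f ≗ g → prodFin m f ≡ prodFin m g
prodFin-cong zero    f≗g = refl
prodFin-cong (suc m) f≗g = cong₂ ℚ._*_ (f≗g zero) (prodFin-cong m (f≗g ∘ suc))

sumFin-combine : ∀ a b (f : Fin (a * b) → ℚ) →
                 sumFin (a * b) f ≡ sumFin a (λ i → sumFin b (λ j → f (combine i j)))
sumFin-combine a b f = begin
  sumFin (a * b) f                                     ≡⟨ sumFin≡∑ (a * b) f ⟩
  ∑ f                                                  ≡⟨ sum-combine ℚ.+-0-monoid a b f ⟩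
  ∑ {a} (λ i → ∑ {b} (λ j → f (combine i j)))          ≡⟨ ∑-cong {a} (λ i → sumFin≡∑ b _) ⟨
  ∑ {a} (λ i → sumFin b (λ j → f (combine i j)))       ≡⟨ sumFin≡∑ a _ ⟨
  sumFin a (λ i → sumFin b (λ j → f (combine i j)))    ∎
  where open ≡-Reasoning

prodFin²≡∏² : ∀ a b (f : Fin a → Fin b → ℚ) →
              prodFin a (λ i → prodFin b (f i)) ≡ ∏ (λ i → ∏ (f i))
prodFin²≡∏² a b f = trans (prodFin≡∏ a _) (∏-cong (λ i → prodFin≡∏ b (f i)))

∏-if : ∀ {n} b (f : Fin n → ℚ) → ∏ (λ i → if b then f i else 1ℚ) ≡ (if b then ∏ f else 1ℚ)
∏-if {n} false f = ∏-replicate-one n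
∏-if     true  f = refl

module _ {a} {A : Set a} where

  ∷-++ : ∀ {m n} (x : A) (xs : Vector A m) (ys : Vector A n) →
         (x ∷ xs) ++ ys ≗ x ∷ (xs ++ ys)
  ∷-++ x xs ys zero = refl
  ∷-++ {m} x xs ys (suc k) with splitAt m k
  ... | inj₁ _ = refl
  ... | inj₂ _ = refl

  concat-head-tail : ∀ {m n} (xss : Vector (Vector A m) (suc n)) →
                     concat xss ≗ head xss ++ concat (tail xss)
  concat-head-tail {m} xss k with splitAt m k
  ... | inj₁ _ = refl
  ... | inj₂ _ = refl

  concat-combine : ∀ {m n} (xss : Vector (Vector A m) n) i j → concat xss (combine i j) ≡ xss i j
  concat-combine xss i j = cong (uncurry xss) (remQuot-combine i j)

quotient-combine : ∀ {m n} (i : Fin m) (j : Fin n) → quotient n (combine i j) ≡ i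
quotient-combine i j = cong proj₁ (remQuot-combine i j)

remainder-combine : ∀ {m n} (i : Fin m) (j : Fin n) → remainder {m} n (combine i j) ≡ j
remainder-combine i j = cong proj₂ (remQuot-combine i j)

finToFun-combine : ∀ {m b} (i : Fin m) (c : Fin (m ^ b)) → finToFun {m} {suc b} (combine i c) ≗ i ∷ finToFun c
finToFun-combine i c zero    = quotient-combine i c
finToFun-combine {m} i c (suc k) = cong (λ r → finToFun r k) (remainder-combine {m} i c)

sumMaps-cong : ∀ n m {F G : (Fin n → Fin m) → ℚ} → F ≗ G → sumMaps n m F ≡ sumMaps n m G
sumMaps-cong zero    m F≗G = F≗G _
sumMaps-cong (suc n) m F≗G = sumFin-cong m (λ i → sumMaps-cong n m (λ φ → F≗G (i ∷ φ)))

sumMaps-++ : ∀ b c m (F : (Fin (b + c) → Fin m) → ℚ) → F Preserves _≗_ ⟶ _≡_ →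
             sumMaps (b + c) m F ≡ sumMaps b m (λ φ → sumMaps c m (λ χ → F (φ ++ χ)))
sumMaps-++ zero    c m F F-cong = sumMaps-cong c m (λ χ → F-cong (λ _ → refl))
sumMaps-++ (suc b) c m F F-cong = sumFin-cong m λ i → begin
  sumMaps (b + c) m (λ φ → F (i ∷ φ))
    ≡⟨ sumMaps-++ b c m (λ φ → F (i ∷ φ)) (λ φ≗ψ → F-cong (∷-cong refl φ≗ψ)) ⟩
  sumMaps b m (λ φ → sumMaps c m (λ χ → F (i ∷ (φ ++ χ))))
    ≡⟨ sumMaps-cong b m (λ φ → sumMaps-cong c m (λ χ → F-cong (∷-++ i φ χ))) ⟨
  sumMaps b m (λ φ → sumMaps c m (λ χ → F ((i ∷ φ) ++ χ)))
    ∎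
  where open ≡-Reasoning

sumMaps-finToFun : ∀ b m (F : (Fin b → Fin m) → ℚ) → F Preserves _≗_ ⟶ _≡_ →
                   sumMaps b m F ≡ sumFin (m ^ b) (F ∘ finToFun)
sumMaps-finToFun zero    m F F-cong = trans (F-cong (λ ())) (sym (ℚ.+-identityʳ _))
sumMaps-finToFun (suc b) m F F-cong = begin
  sumFin m (λ i → sumMaps b m (λ φ → F (i ∷ φ)))
    ≡⟨ sumFin-cong m (λ i → sumMaps-finToFun b m (λ φ → F (i ∷ φ)) (λ φ≗ψ → F-cong (∷-cong refl φ≗ψ))) ⟩
  sumFin m (λ i → sumFin (m ^ b) (λ c → F (i ∷ finToFun c)))
    ≡⟨ sumFin-cong m (λ i → sumFin-cong (m ^ b) (λ c → F-cong (finToFun-combine i c))) ⟨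
  sumFin m (λ i → sumFin (m ^ b) (λ c → F (finToFun (combine i c))))
    ≡⟨ sumFin-combine m (m ^ b) (F ∘ finToFun) ⟨
  sumFin (m * m ^ b) (F ∘ finToFun)
    ∎
  where open ≡-Reasoning

sumMaps-concat : ∀ a b m (F : (Fin (a * b) → Fin m) → ℚ) → F Preserves _≗_ ⟶ _≡_ →
                 sumMaps (a * b) m F ≡ sumMaps a (m ^ b) (λ ψ → F (concat (finToFun ∘ ψ)))
sumMaps-concat zero    b m F F-cong = F-cong (λ ())
sumMaps-concat (suc a) b m F F-cong = begin
  sumMaps (b + a * b) m F
    ≡⟨ sumMaps-++ b (a * b) m F F-cong ⟩
  sumMaps b m (λ φ → sumMaps (a * b) m (λ χ → F (φ ++ χ)))
    ≡⟨ sumMaps-cong b m (λ φ → sumMaps-concat a b m (λ χ → F (φ ++ χ)) (F-cong ∘ ++-cong φ φ (λ _ → refl))) ⟩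
  sumMaps b m (λ φ → sumMaps a (m ^ b) (λ ψ → F (φ ++ concat (finToFun ∘ ψ))))
    ≡⟨ sumMaps-finToFun b m _ (λ φ≗φ′ → sumMaps-cong a (m ^ b) (λ ψ → F-cong (++-cong _ _ φ≗φ′ (λ _ → refl)))) ⟩
  sumFin (m ^ b) (λ c → sumMaps a (m ^ b) (λ ψ → F (finToFun c ++ concat (finToFun ∘ ψ))))
    ≡⟨ sumFin-cong (m ^ b) (λ c → sumMaps-cong a (m ^ b) (λ ψ → F-cong (concat-head-tail (finToFun ∘ (c ∷ ψ))))) ⟨
  sumMaps (suc a) (m ^ b) (λ ψ → F (concat (finToFun ∘ ψ)))
    ∎
  where open ≡-Reasoning

combine-cancelˡ-< : ∀ {m n} {u v : Fin m} (i j : Fin n) → u ≢ v → combine u i < combine v j → u < v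
combine-cancelˡ-< {u = u} {v} i j u≢v ui<vj with <-cmp u v
... | tri< u<v _ _ = u<v
... | tri≈ _ u≡v _ = ⊥-elim (u≢v u≡v)
... | tri> _ _ v<u = ⊥-elim (<-asym ui<vj (combine-monoˡ-< j i v<u))

combine-<ᵇ : ∀ {m n} {u v : Fin m} (i j : Fin n) → u ≢ v →
             (toℕ (combine u i) <ᵇ toℕ (combine v j)) ≡ (toℕ u <ᵇ toℕ v)
combine-<ᵇ {u = u} {v} i j u≢v = det (<ᵇ-reflects-< _ _)
  (fromEquivalence (λ u<ᵇv → combine-monoˡ-< i j (<ᵇ⇒< (toℕ u) (toℕ v) u<ᵇv))
                   (λ ui<vj → <⇒<ᵇ (combine-cancelˡ-< i j u≢v ui<vj)))

module _ (G : SimpleGraph) where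
  open SimpleGraph G using (n; adj; noLoop)

  adj⇒≢ : ∀ {u v} → adj u v ≡ true → u ≢ v
  adj⇒≢ {u} uv refl with () ← trans (sym uv) (noLoop u)

  orientedEdge : Fin n → Fin n → Bool
  orientedEdge u v = (toℕ u <ᵇ toℕ v) ∧ adj u v

  module _ (W : WeightedGraph) where
    open WeightedGraph W using (m; β)

    edgeFactor : (Fin n → Fin m) → Fin n → Fin n → ℚ
    edgeFactor φ u v = if orientedEdge u v then β (φ u) (φ v) else 1ℚ

    homTerm : (Fin n → Fin m) → ℚ
    homTerm φ = prodFin n (λ u → prodFin n (edgeFactor φ u))

    homTerm-cong : homTerm Preserves _≗_ ⟶ _≡_
    homTerm-cong φ≗ψ = prodFin-cong n λ u → prodFin-cong n λ v →
      if-cong-then (orientedEdge u v) (cong₂ β (φ≗ψ u) (φ≗ψ v))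

module _ (W : WeightedGraph) (H : LoopedSimpleGraph) where
  open WeightedGraph W using (m; β; symβ)
  open LoopedSimpleGraph H using (n; adj) renaming (sym to adj-sym)

  -- hom counts an edge (u, i)(v, j) of G × H once, oriented so that u < v;
  -- over a fixed edge uv of G every ordered pair (i, j) with ij ∈ E(H) occurs.
  powerWeight : Fin (m ^ n) → Fin (m ^ n) → ℚ
  powerWeight c d = ∏ (λ i → ∏ (λ j → if adj i j then β (finToFun c i) (finToFun d j) else 1ℚ))

  powerWeight-sym : ∀ c d → powerWeight c d ≡ powerWeight d c
  powerWeight-sym c d = trans (∏-comm {n} {n} _) (∏-cong λ j → ∏-cong λ i →
    trans (if-cong (adj-sym i j)) (if-cong-then (adj j i) (symβ _ _)))

  _^ᵂ_ : WeightedGraph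
  _^ᵂ_ = record { m = m ^ n ; β = powerWeight ; symβ = powerWeight-sym }

module _ (G : SimpleGraph) (H : LoopedSimpleGraph) where
  private
    module G = SimpleGraph G
    module H = LoopedSimpleGraph H

  adj-×ᵍ : ∀ u v i j →
           SimpleGraph.adj (G ×ᵍ H) (combine u i) (combine v j) ≡ G.adj u v ∧ H.adj i j
  adj-×ᵍ u v i j = cong₂ _∧_
    (cong₂ G.adj (quotient-combine u i) (quotient-combine v j))
    (cong₂ H.adj (remainder-combine {G.n} u i) (remainder-combine {G.n} v j))

  orientedEdge-×ᵍ : ∀ u v i j →
    orientedEdge (G ×ᵍ H) (combine u i) (combine v j) ≡ orientedEdge G u v ∧ H.adj i j
  orientedEdge-×ᵍ u v i j rewrite adj-×ᵍ u v i j with G.adj u v in uv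
  ... | false = trans (∧-zeroʳ _) (cong (_∧ H.adj i j) (sym (∧-zeroʳ _)))
  ... | true  = trans (cong (_∧ H.adj i j) (combine-<ᵇ i j (adj⇒≢ G uv)))
                      (cong (_∧ H.adj i j) (sym (∧-identityʳ _)))

  module _ (W : WeightedGraph) (ψ : Fin G.n → Fin (WeightedGraph.m W ^ H.n)) where
    open WeightedGraph W using (β)

    edgeFactor-×ᵍ : ∀ u v i j →
      edgeFactor (G ×ᵍ H) W (concat (finToFun ∘ ψ)) (combine u i) (combine v j)
      ≡ (if orientedEdge G u v
           then (if H.adj i j then β (finToFun (ψ u) i) (finToFun (ψ v) j) else 1ℚ)
           else 1ℚ)
    edgeFactor-×ᵍ u v i j = begin
      edgeFactor (G ×ᵍ H) W (concat (finToFun ∘ ψ)) (combine u i) (combine v j)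
        ≡⟨ if-cong-then (orientedEdge (G ×ᵍ H) (combine u i) (combine v j))
                      (cong₂ β (concat-combine (finToFun ∘ ψ) u i) (concat-combine (finToFun ∘ ψ) v j)) ⟩
      (if orientedEdge (G ×ᵍ H) (combine u i) (combine v j) then β (finToFun (ψ u) i) (finToFun (ψ v) j) else 1ℚ)
        ≡⟨ if-cong (orientedEdge-×ᵍ u v i j) ⟩
      (if orientedEdge G u v ∧ H.adj i j then β (finToFun (ψ u) i) (finToFun (ψ v) j) else 1ℚ)
        ≡⟨ if-∧ (orientedEdge G u v) ⟩
      (if orientedEdge G u v
         then (if H.adj i j then β (finToFun (ψ u) i) (finToFun (ψ v) j) else 1ℚ)
         else 1ℚ) ∎
      where open ≡-Reasoning

    homTerm-×ᵍ : homTerm (G ×ᵍ H) W (concat (finToFun ∘ ψ)) ≡ homTerm G (W ^ᵂ H) ψ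
    homTerm-×ᵍ = begin
      homTerm (G ×ᵍ H) W φ
        ≡⟨ prodFin²≡∏² (G.n * H.n) (G.n * H.n) (edgeFactor (G ×ᵍ H) W φ) ⟩
      ∏ (λ x → ∏ (λ y → E x y))
        ≡⟨ sum-combine ℚ.*-1-monoid G.n H.n _ ⟩
      ∏ {G.n} (λ u → ∏ {H.n} (λ i → ∏ (λ y → E (combine u i) y)))
        ≡⟨ ∏-cong {G.n} (λ u → ∏-cong {H.n} (λ i → sum-combine ℚ.*-1-monoid G.n H.n _)) ⟩
      ∏ {G.n} (λ u → ∏ {H.n} (λ i → ∏ {G.n} (λ v → ∏ {H.n} (λ j → E (combine u i) (combine v j)))))
        ≡⟨ ∏-cong {G.n} (λ u → ∏-comm {H.n} {G.n} _) ⟩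
      ∏ {G.n} (λ u → ∏ {G.n} (λ v → ∏ {H.n} (λ i → ∏ {H.n} (λ j → E (combine u i) (combine v j)))))
        ≡⟨ ∏-cong {G.n} (λ u → ∏-cong {G.n} (λ v → ∏-cong {H.n} (λ i → ∏-cong {H.n} (edgeFactor-×ᵍ u v i)))) ⟩
      ∏ {G.n} (λ u → ∏ {G.n} (λ v → ∏ {H.n} (λ i → ∏ {H.n} (λ j → if orientedEdge G u v then F u v i j else 1ℚ))))
        ≡⟨ ∏-cong {G.n} (λ u → ∏-cong {G.n} (λ v → ∏²-if (orientedEdge G u v) (F u v))) ⟩
      ∏ {G.n} (λ u → ∏ {G.n} (λ v → edgeFactor G (W ^ᵂ H) ψ u v))
        ≡⟨ prodFin²≡∏² G.n G.n (edgeFactor G (W ^ᵂ H) ψ) ⟨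
      homTerm G (W ^ᵂ H) ψ ∎
      where
      open ≡-Reasoning
      φ = concat (finToFun ∘ ψ)
      E = edgeFactor (G ×ᵍ H) W φ
      F : Fin G.n → Fin G.n → Fin H.n → Fin H.n → ℚ
      F u v i j = if H.adj i j then β (finToFun (ψ u) i) (finToFun (ψ v) j) else 1ℚ
      ∏²-if : ∀ b (f : Fin H.n → Fin H.n → ℚ) →
              ∏ (λ i → ∏ (λ j → if b then f i j else 1ℚ)) ≡ (if b then ∏ (λ i → ∏ (f i)) else 1ℚ)
      ∏²-if b f = trans (∏-cong (λ i → ∏-if b (f i))) (∏-if b (λ i → ∏ (f i)))

hom-×ᵍ : ∀ G H W → hom (G ×ᵍ H) W ≡ hom G (W ^ᵂ H)
hom-×ᵍ G H W = begin
  hom (G ×ᵍ H) W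
    ≡⟨ sumMaps-concat G.n H.n m (homTerm (G ×ᵍ H) W) (homTerm-cong (G ×ᵍ H) W) ⟩
  sumMaps G.n (m ^ H.n) (λ ψ → homTerm (G ×ᵍ H) W (concat (finToFun ∘ ψ)))
    ≡⟨ sumMaps-cong G.n (m ^ H.n) (homTerm-×ᵍ G H W) ⟩
  hom G (W ^ᵂ H) ∎
  where
  open ≡-Reasoning
  module G = SimpleGraph G
  module H = LoopedSimpleGraph H
  open WeightedGraph W using (m)

mainTheorem3 : (G : SimpleGraph) (H : LoopedSimpleGraph) → Positive G → Positive (G ×ᵍ H)
mainTheorem3 G H G-positive W = subst (0ℚ ≤_) (sym (hom-×ᵍ G H W)) (G-positive (W ^ᵂ H))
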